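{- Let $p_1,p_2$ be integers with $p_1\ge p_2\ge 0$ and $p_1>0$, and let $G_0$ be the infinite hexagonal tube of type $(p_1,p_2)$. Then there is a maximal matching $M_0$ of $G_0$ such that every hexagonal face of $G_0$ has exactly two of its six vertices not covered by $M_0$.
   Context: Consider the (infinite, planar) hexagonal grid, i.e. the honeycomb lattice in which every face is a hexagon, with unit lattice vectors $\vec a_1,\vec a_2$ joining centers of adjacent hexagons (at an angle of 60 degrees). The infinite hexagonal tube of type $(p_1,p_2)$ is the infinite cubic graph embedded on a cylinder obtained from this grid by identifying all vertices, edges and faces that differ by an integer multiple of the translation vector $p_1\vec a_1+p_2\vec a_2$. A matching is a set of pairwise disjoint edges; it is maximal if no edge can be added to it while keeping it a matching. A vertex is covered by a matching if it is an endpoint of one of its edges. -}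

module Defs where

open import Data.Nat as ℕ using (ℕ; NonZero)
open import Data.Integer using (ℤ; +_; _+_; _-_; _*_)
open import Data.Integer.DivMod using (_%ℕ_; _/ℕ_; n%ℕd<d)
open import Data.Fin using (Fin; toℕ; fromℕ<; zero; suc)
open import Data.Product using (Σ; ∃; _×_; _,_)
open import Data.Sum using (_⊎_)
open import Relation.Binary.PropositionalEquality using (_≡_; _≢_)
open import Relation.Nullary using (¬_)
open import Function.Bundles using (_⇔_)

-- Honeycomb lattice: hexagon centres are the triangular lattice points
-- i·a₁ + j·a₂ ≅ (i , j) ∈ ℤ².  Vertices of the honeycomb are the triangles of
-- the triangular lattice:
--   A(i,j) = up-triangle   {(i,j), (i+1,j), (i,j+1)}
--   B(i,j) = down-triangle {(i+1,j), (i,j+1), (i+1,j+1)}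
-- A(i,j) is adjacent to B(i,j), B(i-1,j), B(i,j-1).

data Side : Set where
  A B : Side

-- The tube of type (p₁,p₂): identify everything differing by multiples of
-- (p₁,p₂).  Since p₁ > 0 every orbit of lattice points (i,j) has a unique
-- representative with 0 ≤ i < p₁, so orbits are  Fin p₁ × ℤ.
module Tube (p₁ p₂ : ℕ) .{{_ : NonZero p₁}} where

  norm : ℤ → ℤ → Fin p₁ × ℤ
  norm i j = fromℕ< (n%ℕd<d i p₁) , j - (i /ℕ p₁) * + p₂

  toℤ : Fin p₁ → ℤ
  toℤ k = + toℕ k

  Vertex : Set
  Vertex = Side × Fin p₁ × ℤ

  -- edges of the tube: orbits of lattice edges; each lattice edge is
  -- determined by its A-endpoint and one of three directions
  -- (0 : to B(i,j), 1 : to B(i-1,j), 2 : to B(i,j-1)).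
  Edge : Set
  Edge = Fin p₁ × ℤ × Fin 3

  aEnd : Edge → Vertex
  aEnd (i , j , _) = A , i , j

  bEnd : Edge → Vertex
  bEnd (i , j , zero)        = B , norm (toℤ i) j
  bEnd (i , j , suc zero)    = B , norm (toℤ i - + 1) j
  bEnd (i , j , suc (suc zero)) = B , norm (toℤ i) (j - + 1)

  IsEnd : Vertex → Edge → Set
  IsEnd v e = v ≡ aEnd e ⊎ v ≡ bEnd e

  Meet : Edge → Edge → Set
  Meet e f = ∃ λ v → IsEnd v e × IsEnd v f

  IsMatching : (Edge → Set) → Set
  IsMatching M = ∀ e f → M e → M f → e ≢ f → ¬ Meet e f

  IsMaximalMatching : (Edge → Set) → Set
  IsMaximalMatching M =
    IsMatching M × (∀ e → ¬ M e → ¬ IsMatching (λ f → M f ⊎ f ≡ e))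

  Covered : (Edge → Set) → Vertex → Set
  Covered M v = ∃ λ e → M e × IsEnd v e

  Face : Set
  Face = Fin p₁ × ℤ

  -- the six vertices of a face (listed with multiplicity)
  faceVertex : Face → Fin 6 → Vertex
  faceVertex (i , j) zero = A , norm (toℤ i) j
  faceVertex (i , j) (suc zero) = A , norm (toℤ i - + 1) j
  faceVertex (i , j) (suc (suc zero)) = A , norm (toℤ i) (j - + 1)
  faceVertex (i , j) (suc (suc (suc zero))) = B , norm (toℤ i - + 1) j
  faceVertex (i , j) (suc (suc (suc (suc zero)))) = B , norm (toℤ i) (j - + 1)
  faceVertex (i , j) (suc (suc (suc (suc (suc zero))))) =
    B , norm (toℤ i - + 1) (j - + 1)

  ExactlyTwoUncovered : (Edge → Set) → Face → Set
  ExactlyTwoUncovered M h =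
    Σ (Fin 6) λ a → Σ (Fin 6) λ b → a ≢ b ×
      (∀ k → (¬ Covered M (faceVertex h k)) ⇔ (k ≡ a ⊎ k ≡ b))

-- Label every lattice point (x , y) by the residue of α x + β y modulo 6 and match the
-- A-vertex at (x , y) along a direction that depends only on this label (or not at all).
-- Whether this is a matching, whether every edge meets it, and which vertices of a hexagon
-- stay uncovered then depend only on the labels involved, so for a fixed pattern each is a
-- finite check over residues. When 6 ∣ α p₁ + β p₂ the labelling is invariant under the
-- translation (p₁ , p₂) and descends to the tube; six patterns are enough for every residue
-- class of (p₁ , p₂) modulo 6 to be served by one of them.
module Submission where

open import Defs
open import Data.Nat as ℕ using (ℕ; NonZero; _≤_)
import Data.Nat.Properties as ℕₚ
open import Data.Nat.DivMod using (m≡m%n+[m/n]*n; m%n<n)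
open import Data.Nat.Divisibility using (_∣_; _∣?_; quotient; ∣m∣n⇒∣m+n; n∣m*n)
import Data.Nat.Tactic.RingSolver as ℕ-Solver
open import Data.Integer using (ℤ; +_; _+_; _-_; _*_; -_; ∣_∣; _⊖_; 0ℤ; 1ℤ; -1ℤ)
import Data.Integer.Properties as ℤₚ
open import Data.Integer.DivMod using (_%ℕ_; _/ℕ_; n%ℕd<d; a≡a%ℕn+[a/ℕn]*n)
open import Data.Integer.Tactic.RingSolver using (solve-∀)
open import Data.Fin using (Fin; zero; suc; toℕ; fromℕ<; #_)
import Data.Fin.Properties as Finₚ
open import Data.Maybe using (Maybe; just; nothing)
import Data.Maybe.Properties as Maybeₚ
open import Data.Vec using (_∷_; []; lookup)
open import Data.List using (List; _∷_; [])
open import Data.List.Relation.Unary.All as All using (All)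
open import Data.List.Relation.Unary.Any as Any using (Any)
open import Data.Product using (Σ; ∃; _×_; _,_; proj₁; proj₂)
open import Data.Sum using (_⊎_; inj₁; inj₂)
open import Function.Bundles using (_⇔_; mk⇔; module Equivalence)
open import Function.Construct.Composition using (_⇔-∘_)
open import Function.Related.TypeIsomorphisms using (¬-cong-⇔)
open import Relation.Binary.PropositionalEquality
open import Relation.Nullary using (¬_; Dec)
open import Relation.Nullary.Decidable using (map′; from-yes; ¬?; _×-dec_; _⊎-dec_; _→-dec_)

_⇔-dec_ : ∀ {a b} {A : Set a} {B : Set b} → Dec A → Dec B → Dec (A ⇔ B)
a? ⇔-dec b? = map′ (λ (f , g) → mk⇔ f g) (λ e → Equivalence.to e , Equivalence.from e)
  ((a? →-dec b?) ×-dec (b? →-dec a?))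

module _ (d : ℕ) .{{_ : NonZero d}} where

  divMod-unique : ∀ x r q → r ℕ.< d → x ≡ + r + q * + d → x %ℕ d ≡ r × x /ℕ d ≡ q
  divMod-unique x r q r<d x≡ =
    ℤₚ.+-injective (ℤₚ.i-j≡0⇒i≡j _ _ r′-r≡0) , sym (ℤₚ.i-j≡0⇒i≡j q q′ q-q′≡0)
    where
    r′ = x %ℕ d
    q′ = x /ℕ d

    rearrange : ∀ a b u v D → a + u * D ≡ b + v * D → a - b ≡ (v - u) * D
    rearrange a b u v D eq = begin
      a - b                                   ≡⟨ regroup a b u v D ⟩
      (a + u * D) - (b + v * D) + (v - u) * D ≡⟨ cong (λ z → z - (b + v * D) + (v - u) * D) eq ⟩
      (b + v * D) - (b + v * D) + (v - u) * D ≡⟨ cancel (b + v * D) ((v - u) * D) ⟩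
      (v - u) * D                             ∎
      where
      open ≡-Reasoning
      regroup : ∀ a b u v D → a - b ≡ (a + u * D) - (b + v * D) + (v - u) * D
      regroup = solve-∀
      cancel : ∀ x y → x - x + y ≡ y
      cancel = solve-∀

    r′-r≡ : + r′ - + r ≡ (q - q′) * + d
    r′-r≡ = rearrange (+ r′) (+ r) q′ q (+ d) (trans (sym (a≡a%ℕn+[a/ℕn]*n x d)) x≡)

    -- |r′ − r| < d, yet it is the multiple |q − q′| * d of d.
    ∣q-q′∣*d<d : ∣ q - q′ ∣ ℕ.* d ℕ.< d
    ∣q-q′∣*d<d = begin-strict
      ∣ q - q′ ∣ ℕ.* d  ≡⟨ ℤₚ.abs-* (q - q′) (+ d) ⟨
      ∣ (q - q′) * + d ∣ ≡⟨ cong ∣_∣ (trans (sym r′-r≡) (ℤₚ.m-n≡m⊖n r′ r)) ⟩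
      ∣ r′ ⊖ r ∣        ≤⟨ ℤₚ.∣m⊝n∣≤m⊔n r′ r ⟩
      r′ ℕ.⊔ r          <⟨ ℕₚ.⊔-lub (n%ℕd<d x d) r<d ⟩
      d                 ∎
      where open ℕₚ.≤-Reasoning

    q-q′≡0 : q - q′ ≡ 0ℤ
    q-q′≡0 = ℤₚ.∣i∣≡0⇒i≡0 (ℕₚ.n<1⇒n≡0 (ℕₚ.*-cancelʳ-< d _ 1
               (subst (∣ q - q′ ∣ ℕ.* d ℕ.<_) (sym (ℕₚ.*-identityˡ d)) ∣q-q′∣*d<d)))

    r′-r≡0 : + r′ - + r ≡ 0ℤ
    r′-r≡0 = trans r′-r≡ (cong (_* + d) q-q′≡0)

module Residue (n : ℕ) .{{_ : NonZero n}} where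

  residue : ℤ → Fin n
  residue z = fromℕ< (n%ℕd<d z n)

  infixl 6 _⊕_
  _⊕_ : Fin n → ℤ → Fin n
  c ⊕ z = residue (+ toℕ c + z)

  residue-periodic : ∀ x m → residue (x + m * + n) ≡ residue x
  residue-periodic x m = Finₚ.fromℕ<-cong _ _ (proj₁ unique) _ _
    where
    +-*-assoc : ∀ r q m N → r + q * N + m * N ≡ r + (q + m) * N
    +-*-assoc = solve-∀
    x+mn≡ : x + m * + n ≡ + (x %ℕ n) + (x /ℕ n + m) * + n
    x+mn≡ = trans (cong (_+ m * + n) (a≡a%ℕn+[a/ℕn]*n x n)) (+-*-assoc (+ (x %ℕ n)) (x /ℕ n) m (+ n))
    unique = divMod-unique n (x + m * + n) (x %ℕ n) (x /ℕ n + m) (n%ℕd<d x n) x+mn≡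

  residue-+ : ∀ x y → residue (x + y) ≡ residue x ⊕ y
  residue-+ x y = begin
    residue (x + y)                               ≡⟨ cong (λ z → residue (z + y)) (a≡a%ℕn+[a/ℕn]*n x n) ⟩
    residue (+ (x %ℕ n) + x /ℕ n * + n + y)       ≡⟨ cong residue (swap (+ (x %ℕ n)) (x /ℕ n * + n) y) ⟩
    residue (+ (x %ℕ n) + y + x /ℕ n * + n)       ≡⟨ residue-periodic (+ (x %ℕ n) + y) (x /ℕ n) ⟩
    residue (+ (x %ℕ n) + y)                      ≡⟨ cong (λ r → residue (+ r + y)) (Finₚ.toℕ-fromℕ< (n%ℕd<d x n)) ⟨
    residue x ⊕ y                                 ∎
    where
    open ≡-Reasoning
    swap : ∀ a b c → a + b + c ≡ a + c + b
    swap = solve-∀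

open Residue 6

form : ℕ → ℕ → ℤ × ℤ → ℤ
form α β (a , b) = + α * a + + β * b

neg : ℤ × ℤ → ℤ × ℤ
neg (a , b) = - a , - b

-- The direction-d edge at the B-vertex of a point q has its A-end at q + forward d, so
-- endOffset s d leads from a vertex of side s to the A-end of its direction-d edge;
-- faceOffset k is the point of faceVertex h k relative to h.
forward : Fin 3 → ℤ × ℤ
forward zero             = 0ℤ , 0ℤ
forward (suc zero)       = 1ℤ , 0ℤ
forward (suc (suc zero)) = 0ℤ , 1ℤ

endOffset : Side → Fin 3 → ℤ × ℤ
endOffset A _ = 0ℤ , 0ℤ
endOffset B d = forward d

faceSide : Fin 6 → Side
faceSide zero             = A
faceSide (suc zero)       = A
faceSide (suc (suc zero)) = A
faceSide _                = B

faceOffset : Fin 6 → ℤ × ℤ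
faceOffset zero                               = 0ℤ , 0ℤ
faceOffset (suc zero)                         = -1ℤ , 0ℤ
faceOffset (suc (suc zero))                   = 0ℤ , -1ℤ
faceOffset (suc (suc (suc zero)))             = -1ℤ , 0ℤ
faceOffset (suc (suc (suc (suc zero))))       = 0ℤ , -1ℤ
faceOffset (suc (suc (suc (suc (suc zero))))) = -1ℤ , -1ℤ

module Orbit (p₁ p₂ : ℕ) .{{_ : NonZero p₁}} where
  open Tube p₁ p₂

  Point : Set
  Point = Fin p₁ × ℤ

  move : Point → ℤ × ℤ → Point
  move (k , l) (a , b) = norm (toℤ k + a) (l + b)

  private
    +-*-assoc : ∀ r q m N → r + q * N + m * N ≡ r + (q + m) * N
    +-*-assoc = solve-∀
    +-*-swap : ∀ r q a N → r + q * N + a ≡ r + a + q * N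
    +-*-swap = solve-∀
    -+-*-cancel : ∀ y q N → y ≡ y - q * N + q * N
    -+-*-cancel = solve-∀

  norm-decomp₁ : ∀ x y → x ≡ toℤ (proj₁ (norm x y)) + x /ℕ p₁ * + p₁
  norm-decomp₁ x y = trans (a≡a%ℕn+[a/ℕn]*n x p₁)
    (cong (λ r → + r + x /ℕ p₁ * + p₁) (sym (Finₚ.toℕ-fromℕ< (n%ℕd<d x p₁))))

  norm-decomp₂ : ∀ x y → y ≡ proj₂ (norm x y) + x /ℕ p₁ * + p₂
  norm-decomp₂ x y = -+-*-cancel y (x /ℕ p₁) (+ p₂)

  norm-translate : ∀ k l m → norm (toℤ k + m * + p₁) (l + m * + p₂) ≡ (k , l)
  norm-translate k l m = cong₂ _,_
    (trans (Finₚ.fromℕ<-cong _ _ (proj₁ unique) _ (Finₚ.toℕ<n k)) (Finₚ.fromℕ<-toℕ k _))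
    (trans (cong (λ q → l + m * + p₂ - q * + p₂) (proj₂ unique)) (+-*-cancel l m (+ p₂)))
    where
    unique = divMod-unique p₁ (toℤ k + m * + p₁) (toℕ k) m (Finₚ.toℕ<n k) refl
    +-*-cancel : ∀ l m N → l + m * N - m * N ≡ l
    +-*-cancel = solve-∀

  norm-periodic : ∀ x y m → norm (x + m * + p₁) (y + m * + p₂) ≡ norm x y
  norm-periodic x y m = begin
    norm (x + m * + p₁) (y + m * + p₂)
      ≡⟨ cong₂ (λ u v → norm (u + m * + p₁) (v + m * + p₂)) (norm-decomp₁ x y) (norm-decomp₂ x y) ⟩
    norm (toℤ k + q * + p₁ + m * + p₁) (l + q * + p₂ + m * + p₂)
      ≡⟨ cong₂ norm (+-*-assoc (toℤ k) q m (+ p₁)) (+-*-assoc l q m (+ p₂)) ⟩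
    norm (toℤ k + (q + m) * + p₁) (l + (q + m) * + p₂)
      ≡⟨ norm-translate k l (q + m) ⟩
    norm x y ∎
    where
    open ≡-Reasoning
    k = proj₁ (norm x y)
    l = proj₂ (norm x y)
    q = x /ℕ p₁

  move-norm : ∀ x y v → move (norm x y) v ≡ norm (x + proj₁ v) (y + proj₂ v)
  move-norm x y (a , b) = begin
    norm (toℤ k + a) (l + b)                              ≡⟨ norm-periodic (toℤ k + a) (l + b) q ⟨
    norm (toℤ k + a + q * + p₁) (l + b + q * + p₂)        ≡⟨ cong₂ norm (+-*-swap (toℤ k) q a (+ p₁)) (+-*-swap l q b (+ p₂)) ⟨
    norm (toℤ k + q * + p₁ + a) (l + q * + p₂ + b)        ≡⟨ cong₂ (λ u v → norm (u + a) (v + b)) (norm-decomp₁ x y) (norm-decomp₂ x y) ⟨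
    norm (x + a) (y + b)                                  ∎
    where
    open ≡-Reasoning
    k = proj₁ (norm x y)
    l = proj₂ (norm x y)
    q = x /ℕ p₁

  move-zero : ∀ p → move p (0ℤ , 0ℤ) ≡ p
  move-zero (k , l) = norm-translate k l 0ℤ

  move-move : ∀ p u v → move (move p u) v ≡ move p (proj₁ u + proj₁ v , proj₂ u + proj₂ v)
  move-move (k , l) (a , b) (a′ , b′) =
    trans (move-norm (toℤ k + a) (l + b) (a′ , b′))
          (cong₂ norm (ℤₚ.+-assoc (toℤ k) a a′) (ℤₚ.+-assoc l b b′))

  move-neg-move : ∀ p v → move (move p (neg v)) v ≡ p
  move-neg-move p (a , b) = trans (move-move p (neg (a , b)) (a , b))
    (trans (cong₂ (λ u v → move p (u , v)) (ℤₚ.+-inverseˡ a) (ℤₚ.+-inverseˡ b)) (move-zero p))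

  move-move-neg : ∀ p v → move (move p v) (neg v) ≡ p
  move-move-neg p (a , b) = trans (move-move p (a , b) (neg (a , b)))
    (trans (cong₂ (λ u v → move p (u , v)) (ℤₚ.+-inverseʳ a) (ℤₚ.+-inverseʳ b)) (move-zero p))

  private
    move-along₁ : ∀ i j a → move (i , j) (a , 0ℤ) ≡ norm (toℤ i + a) j
    move-along₁ i j a = cong (norm (toℤ i + a)) (ℤₚ.+-identityʳ j)

    move-along₂ : ∀ i j b → move (i , j) (0ℤ , b) ≡ norm (toℤ i) (j + b)
    move-along₂ i j b = cong (λ x → norm x (j + b)) (ℤₚ.+-identityʳ (toℤ i))

    move-origin : ∀ i j → move (i , j) (0ℤ , 0ℤ) ≡ norm (toℤ i) j
    move-origin i j = trans (move-along₂ i j 0ℤ) (cong (norm (toℤ i)) (ℤₚ.+-identityʳ j))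

  bEnd-move : ∀ i j d → bEnd (i , j , d) ≡ (B , move (i , j) (neg (forward d)))
  bEnd-move i j zero             = cong (B ,_) (sym (move-origin i j))
  bEnd-move i j (suc zero)       = cong (B ,_) (sym (move-along₁ i j -1ℤ))
  bEnd-move i j (suc (suc zero)) = cong (B ,_) (sym (move-along₂ i j -1ℤ))

  faceVertex-move : ∀ h k → faceVertex h k ≡ (faceSide k , move h (faceOffset k))
  faceVertex-move (i , j) zero                                = cong (A ,_) (sym (move-origin i j))
  faceVertex-move (i , j) (suc zero)                          = cong (A ,_) (sym (move-along₁ i j -1ℤ))
  faceVertex-move (i , j) (suc (suc zero))                    = cong (A ,_) (sym (move-along₂ i j -1ℤ))
  faceVertex-move (i , j) (suc (suc (suc zero)))              = cong (B ,_) (sym (move-along₁ i j -1ℤ))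
  faceVertex-move (i , j) (suc (suc (suc (suc zero))))        = cong (B ,_) (sym (move-along₂ i j -1ℤ))
  faceVertex-move (i , j) (suc (suc (suc (suc (suc zero))))) = refl

  isEnd⇔ : ∀ s q i j d → IsEnd (s , q) (i , j , d) ⇔ (i , j) ≡ move q (endOffset s d)
  isEnd⇔ A q i j d = mk⇔ to from
    where
    to : IsEnd (A , q) (i , j , d) → (i , j) ≡ move q (0ℤ , 0ℤ)
    to (inj₁ refl) = sym (move-zero q)
    to (inj₂ q≡) with () ← trans q≡ (bEnd-move i j d)
    from : (i , j) ≡ move q (0ℤ , 0ℤ) → IsEnd (A , q) (i , j , d)
    from ij≡ = inj₁ (cong (A ,_) (sym (trans ij≡ (move-zero q))))
  isEnd⇔ B q i j d = mk⇔ to from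
    where
    to : IsEnd (B , q) (i , j , d) → (i , j) ≡ move q (forward d)
    to (inj₁ ())
    to (inj₂ q≡) with refl ← trans q≡ (bEnd-move i j d) = sym (move-neg-move (i , j) (forward d))
    from : (i , j) ≡ move q (forward d) → IsEnd (B , q) (i , j , d)
    from ij≡ = inj₂ (begin
      (B , q)                                           ≡⟨ cong (B ,_) (move-move-neg q (forward d)) ⟨
      (B , move (move q (forward d)) (neg (forward d))) ≡⟨ cong (λ p → B , move p (neg (forward d))) ij≡ ⟨
      (B , move (i , j) (neg (forward d)))              ≡⟨ bEnd-move i j d ⟨
      bEnd (i , j , d)                                  ∎)
      where open ≡-Reasoning

module Levels (p₁ p₂ : ℕ) .{{_ : NonZero p₁}} (α β : ℕ)
              (period : 6 ∣ α ℕ.* p₁ ℕ.+ β ℕ.* p₂) where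
  open Tube p₁ p₂
  open Orbit p₁ p₂

  level : Point → Fin 6
  level (k , l) = residue (form α β (toℤ k , l))

  private
    form-period : form α β (+ p₁ , + p₂) ≡ + quotient period * + 6
    form-period = begin
      + α * + p₁ + + β * + p₂   ≡⟨ cong₂ _+_ (ℤₚ.pos-* α p₁) (ℤₚ.pos-* β p₂) ⟨
      + (α ℕ.* p₁) + + (β ℕ.* p₂) ≡⟨ ℤₚ.pos-+ (α ℕ.* p₁) (β ℕ.* p₂) ⟨
      + (α ℕ.* p₁ ℕ.+ β ℕ.* p₂)  ≡⟨ cong +_ (_∣_.equality period) ⟩
      + (quotient period ℕ.* 6) ≡⟨ ℤₚ.pos-* (quotient period) 6 ⟩
      + quotient period * + 6 ∎
      where open ≡-Reasoning

    form-+ : ∀ u v a b → form α β (u + a , v + b) ≡ form α β (u , v) + form α β (a , b)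
    form-+ u v a b = lemma (+ α) (+ β) u v a b
      where
      lemma : ∀ α β u v a b → α * (u + a) + β * (v + b) ≡ α * u + β * v + (α * a + β * b)
      lemma = solve-∀

    form-translate : ∀ u v q → form α β (u + q * + p₁ , v + q * + p₂) ≡ form α β (u , v) + q * form α β (+ p₁ , + p₂)
    form-translate u v q = lemma (+ α) (+ β) u v q (+ p₁) (+ p₂)
      where
      lemma : ∀ α β u v q P Q → α * (u + q * P) + β * (v + q * Q) ≡ α * u + β * v + q * (α * P + β * Q)
      lemma = solve-∀

  level-norm : ∀ x y → level (norm x y) ≡ residue (form α β (x , y))
  level-norm x y = begin
    residue (form α β (toℤ k , l))                   ≡⟨ residue-periodic (form α β (toℤ k , l)) (q * t) ⟨
    residue (form α β (toℤ k , l) + q * t * + 6)     ≡⟨ cong (λ z → residue (form α β (toℤ k , l) + z)) (ℤₚ.*-assoc q t (+ 6)) ⟩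
    residue (form α β (toℤ k , l) + q * (t * + 6))   ≡⟨ cong (λ z → residue (form α β (toℤ k , l) + q * z)) form-period ⟨
    residue (form α β (toℤ k , l) + q * form α β (+ p₁ , + p₂)) ≡⟨ cong residue (form-translate (toℤ k) l q) ⟨
    residue (form α β (toℤ k + q * + p₁ , l + q * + p₂)) ≡⟨ cong₂ (λ u v → residue (form α β (u , v))) (norm-decomp₁ x y) (norm-decomp₂ x y) ⟨
    residue (form α β (x , y))                       ∎
    where
    open ≡-Reasoning
    k = proj₁ (norm x y)
    l = proj₂ (norm x y)
    q = x /ℕ p₁
    t = + quotient period

  level-move : ∀ p v → level (move p v) ≡ level p ⊕ form α β v
  level-move (k , l) (a , b) = begin
    level (norm (toℤ k + a) (l + b))                 ≡⟨ level-norm (toℤ k + a) (l + b) ⟩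
    residue (form α β (toℤ k + a , l + b))           ≡⟨ cong residue (form-+ (toℤ k) l a b) ⟩
    residue (form α β (toℤ k , l) + form α β (a , b)) ≡⟨ residue-+ (form α β (toℤ k , l)) (form α β (a , b)) ⟩
    level (k , l) ⊕ form α β (a , b)                 ∎
    where open ≡-Reasoning

module _ (p₁ p₂ : ℕ) .{{_ : NonZero p₁}} where
  open Tube p₁ p₂

  maximal-if-every-edge-touched : ∀ M → IsMatching M → (∀ e → ∃ λ v → IsEnd v e × Covered M v) →
                             IsMaximalMatching M
  maximal-if-every-edge-touched M isM covered = isM , λ e ¬Me isM′ →
    let (v , e-end , f , Mf , f-end) = covered e in
    isM′ f e (inj₁ Mf) (inj₂ refl) (λ f≡e → ¬Me (subst M f≡e Mf)) (v , f-end , e-end)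

-- The A-vertex at a point of level c = (α x + β y) mod 6 is matched along direction d
-- iff choice c ≡ just d.
record Pattern : Set where
  field
    α β    : ℕ
    choice : Fin 6 → Maybe (Fin 3)

  CoveredAt : Side → Fin 6 → Set
  CoveredAt s c = ∃ λ d → choice (c ⊕ form α β (endOffset s d)) ≡ just d

  UniqueAt : Side → Fin 6 → Set
  UniqueAt s c = ∀ d d′ → choice (c ⊕ form α β (endOffset s d)) ≡ just d →
                 choice (c ⊕ form α β (endOffset s d′)) ≡ just d′ → d ≡ d′

  TwoUncoveredAt : Fin 6 → Set
  TwoUncoveredAt c = Σ (Fin 6) λ a → Σ (Fin 6) λ b → a ≢ b ×
    (∀ k → (¬ CoveredAt (faceSide k) (c ⊕ form α β (faceOffset k))) ⇔ (k ≡ a ⊎ k ≡ b))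

  Valid : Set
  Valid = (∀ c → UniqueAt B c) ×
          (∀ c d → CoveredAt A (c ⊕ form α β (forward d)) ⊎ CoveredAt B c) ×
          (∀ c → TwoUncoveredAt c)

  uniqueAt-A : ∀ c → UniqueAt A c
  uniqueAt-A c d d′ h h′ = Maybeₚ.just-injective (trans (sym h) h′)

  private
    choice≟ : ∀ c d → Dec (choice c ≡ just d)
    choice≟ c d = Maybeₚ.≡-dec Finₚ._≟_ (choice c) (just d)

  coveredAt? : ∀ s c → Dec (CoveredAt s c)
  coveredAt? s c = Finₚ.any? λ d → choice≟ _ d

  valid? : Dec Valid
  valid? = Finₚ.all? (λ c → Finₚ.all? λ d → Finₚ.all? λ d′ →
                        choice≟ _ d →-dec choice≟ _ d′ →-dec d Finₚ.≟ d′)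
    ×-dec Finₚ.all? (λ c → Finₚ.all? λ d → coveredAt? A _ ⊎-dec coveredAt? B c)
    ×-dec Finₚ.all? λ c → Finₚ.any? λ a → Finₚ.any? λ b → ¬? (a Finₚ.≟ b) ×-dec
            Finₚ.all? λ k → ¬? (coveredAt? (faceSide k) _) ⇔-dec ((k Finₚ.≟ a) ⊎-dec (k Finₚ.≟ b))

module Construction (p₁ p₂ : ℕ) .{{_ : NonZero p₁}} (P : Pattern) (valid : Pattern.Valid P)
                    (period : 6 ∣ Pattern.α P ℕ.* p₁ ℕ.+ Pattern.β P ℕ.* p₂) where
  open Tube p₁ p₂
  open Orbit p₁ p₂
  open Pattern P
  open Levels p₁ p₂ α β period

  M : Edge → Set
  M (i , j , d) = choice (level (i , j)) ≡ just d

  level-aEnd : ∀ s q i j d → IsEnd (s , q) (i , j , d) → level (i , j) ≡ level q ⊕ form α β (endOffset s d)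
  level-aEnd s q i j d end = trans (cong level (Equivalence.to (isEnd⇔ s q i j d) end)) (level-move q (endOffset s d))

  covered⇔ : ∀ s q → Covered M (s , q) ⇔ CoveredAt s (level q)
  covered⇔ s q = mk⇔ to from
    where
    to : Covered M (s , q) → CoveredAt s (level q)
    to ((i , j , d) , Me , end) = d , trans (cong choice (sym (level-aEnd s q i j d end))) Me
    from : CoveredAt s (level q) → Covered M (s , q)
    from (d , h) = (proj₁ a , proj₂ a , d) , trans (cong choice (level-move q (endOffset s d))) h
                 , Equivalence.from (isEnd⇔ s q (proj₁ a) (proj₂ a) d) refl
      where a = move q (endOffset s d)

  uniqueAt : ∀ s c → UniqueAt s c
  uniqueAt A = uniqueAt-A
  uniqueAt B = proj₁ valid

  M-edge-at-unique : ∀ v e f → M e → M f → IsEnd v e → IsEnd v f → e ≡ f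
  M-edge-at-unique (s , q) (i , j , d) (i′ , j′ , d′) Me Mf e-end f-end =
    cong₂ (λ (x , y) z → x , y , z) ij≡ d≡d′
    where
    d≡d′ : d ≡ d′
    d≡d′ = uniqueAt s (level q) d d′
             (trans (cong choice (sym (level-aEnd s q i j d e-end))) Me)
             (trans (cong choice (sym (level-aEnd s q i′ j′ d′ f-end))) Mf)
    ij≡ : (i , j) ≡ (i′ , j′)
    ij≡ = trans (Equivalence.to (isEnd⇔ s q i j d) e-end)
            (trans (cong (λ x → move q (endOffset s x)) d≡d′)
                   (sym (Equivalence.to (isEnd⇔ s q i′ j′ d′) f-end)))

  isMatching : IsMatching M
  isMatching e f Me Mf e≢f (v , e-end , f-end) = e≢f (M-edge-at-unique v e f Me Mf e-end f-end)

  every-edge-touched : ∀ e → ∃ λ v → IsEnd v e × Covered M v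
  every-edge-touched (i , j , d) = from-cases (proj₁ (proj₂ valid) (level q) d)
    where
    q = move (i , j) (neg (forward d))
    b-end : IsEnd (B , q) (i , j , d)
    b-end = inj₂ (sym (bEnd-move i j d))
    from-cases : CoveredAt A (level q ⊕ form α β (forward d)) ⊎ CoveredAt B (level q) →
                 ∃ λ v → IsEnd v (i , j , d) × Covered M v
    from-cases (inj₁ A-covered) = (A , i , j) , inj₁ refl ,
      Equivalence.from (covered⇔ A (i , j)) (subst (CoveredAt A) (sym (level-aEnd B q i j d b-end)) A-covered)
    from-cases (inj₂ B-covered) = (B , q) , b-end , Equivalence.from (covered⇔ B q) B-covered

  covered-face : ∀ h k → Covered M (faceVertex h k) ⇔ CoveredAt (faceSide k) (level h ⊕ form α β (faceOffset k))
  covered-face h k =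
    subst₂ (λ v c → Covered M v ⇔ CoveredAt (faceSide k) c)
           (sym (faceVertex-move h k)) (level-move h (faceOffset k))
           (covered⇔ (faceSide k) (move h (faceOffset k)))

  twoUncovered : ∀ h → ExactlyTwoUncovered M h
  twoUncovered h with proj₂ (proj₂ valid) (level h)
  ... | a , b , a≢b , spec = a , b , a≢b , λ k → spec k ⇔-∘ ¬-cong-⇔ (covered-face h k)

  maximalMatching : Σ (Edge → Set) λ M → IsMaximalMatching M × (∀ h → ExactlyTwoUncovered M h)
  maximalMatching = M , maximal-if-every-edge-touched p₁ p₂ M isMatching every-edge-touched , twoUncovered

stripes : (α β : ℕ) (d₁ d₂ : Fin 3) → Pattern
stripes α β d₁ d₂ = record
  { α = α ; β = β
  ; choice = lookup (nothing ∷ nothing ∷ just d₁ ∷ just d₁ ∷ just d₂ ∷ just d₂ ∷ [])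
  }

patterns : List Pattern
patterns = stripes 0 2 (# 2) (# 0) ∷ stripes 2 0 (# 1) (# 0) ∷ stripes 2 2 (# 1) (# 0)
         ∷ stripes 1 2 (# 2) (# 0) ∷ stripes 1 5 (# 1) (# 2) ∷ stripes 2 1 (# 1) (# 0) ∷ []

-- Kept opaque so that the decision procedures are never unfolded where their results are used.
opaque
  patterns-valid : All Pattern.Valid patterns
  patterns-valid = from-yes (All.all? Pattern.valid? patterns)

divides-form-mod : ∀ n .{{_ : NonZero n}} α β x y →
                   n ∣ α ℕ.* (x ℕ.% n) ℕ.+ β ℕ.* (y ℕ.% n) → n ∣ α ℕ.* x ℕ.+ β ℕ.* y
divides-form-mod n α β x y n∣ =
  subst (n ∣_) (sym decomp) (∣m∣n⇒∣m+n n∣ (n∣m*n (α ℕ.* (x ℕ./ n) ℕ.+ β ℕ.* (y ℕ./ n))))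
  where
  lemma : ∀ α β r s u v n → α ℕ.* (r ℕ.+ u ℕ.* n) ℕ.+ β ℕ.* (s ℕ.+ v ℕ.* n) ≡
                            α ℕ.* r ℕ.+ β ℕ.* s ℕ.+ (α ℕ.* u ℕ.+ β ℕ.* v) ℕ.* n
  lemma = ℕ-Solver.solve-∀
  decomp : α ℕ.* x ℕ.+ β ℕ.* y ≡ α ℕ.* (x ℕ.% n) ℕ.+ β ℕ.* (y ℕ.% n) ℕ.+ (α ℕ.* (x ℕ./ n) ℕ.+ β ℕ.* (y ℕ./ n)) ℕ.* n
  decomp = trans (cong₂ (λ u v → α ℕ.* u ℕ.+ β ℕ.* v) (m≡m%n+[m/n]*n x n) (m≡m%n+[m/n]*n y n))
                 (lemma α β (x ℕ.% n) (y ℕ.% n) (x ℕ./ n) (y ℕ./ n) n)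

opaque
  patterns-cover : ∀ (r₁ r₂ : Fin 6) →
                   Any (λ P → 6 ∣ Pattern.α P ℕ.* toℕ r₁ ℕ.+ Pattern.β P ℕ.* toℕ r₂) patterns
  patterns-cover = from-yes (Finₚ.all? λ (r₁ : Fin 6) → Finₚ.all? λ (r₂ : Fin 6) →
    Any.any? (λ P → 6 ∣? Pattern.α P ℕ.* toℕ r₁ ℕ.+ Pattern.β P ℕ.* toℕ r₂) patterns)

pattern-for : ∀ p₁ p₂ → Σ Pattern λ P → Pattern.Valid P × 6 ∣ Pattern.α P ℕ.* p₁ ℕ.+ Pattern.β P ℕ.* p₂
pattern-for p₁ p₂ = P , proj₁ found , divides-form-mod 6 (Pattern.α P) (Pattern.β P) p₁ p₂
  (subst₂ (λ r s → 6 ∣ Pattern.α P ℕ.* r ℕ.+ Pattern.β P ℕ.* s)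
          (Finₚ.toℕ-fromℕ< (m%n<n p₁ 6)) (Finₚ.toℕ-fromℕ< (m%n<n p₂ 6)) (proj₂ found))
  where
  cover = patterns-cover (fromℕ< (m%n<n p₁ 6)) (fromℕ< (m%n<n p₂ 6))
  P = Any.lookup cover
  found = All.lookupAny patterns-valid cover

mainTheorem1 : (p₁ p₂ : ℕ) → p₂ ≤ p₁ → .{{_ : NonZero p₁}} →
    Σ (Tube.Edge p₁ p₂ → Set) λ M →
      Tube.IsMaximalMatching p₁ p₂ M ×
      (∀ h → Tube.ExactlyTwoUncovered p₁ p₂ M h)
-- The construction works for all p₂.
mainTheorem1 p₁ p₂ _ =
  Construction.maximalMatching p₁ p₂ (proj₁ chosen) (proj₁ (proj₂ chosen)) (proj₂ (proj₂ chosen))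
  where chosen = pattern-for p₁ p₂
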